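{- Let $G$ be a totally ordered graph and let $x_0x_1$ be an edge of $G$ of height $r$. If $t$ is a positive integer with $\binom{t}{2}<r$, then $G$ contains a monotone path $x_0x_1\ldots x_t$ of height at least $r-\binom{t}{2}$.
   Context: A totally ordered graph is a (finite) graph $G$ together with a total ordering $T(G)$ of $V(G)$ and a total ordering $T'(G)$ of $E(G)$. A monotone path is a path $x_0x_1\ldots x_k$ whose edges $x_0x_1,\ldots,x_{k-1}x_k$ are increasing in $T'(G)$; its length is $k$. The height table of $G$ is an array $A$ with columns indexed by $V(G)$ and rows indexed by the positive integers; cell $A(i,u)$ precedes $A(i',u')$ iff $i<i'$, or $i=i'$ and $u$ precedes $u'$ in $T(G)$. The cells are filled in this order: $A(i,u)$ is the largest edge (in $T'(G)$) incident to $u$ that does not appear in a preceding cell, and is empty if no such edge exists. Each edge appears in exactly one cell; the height $h_G(e)$ of an edge $e$ is the index of the row containing $e$. The height of a monotone path $x_0\ldots x_k$ with $k\ge1$ is the height of its last edge $x_{k-1}x_k$. -}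

module Defs where

open import Data.Nat using (ℕ; zero; suc; _≡ᵇ_)
open import Data.Fin using (Fin; _≟_)
open import Data.Product using (_×_; _,_; proj₁; proj₂)
open import Data.Sum using (_⊎_)
open import Data.Bool using (Bool; true; false; _∧_; _∨_; if_then_else_)
open import Data.Maybe using (Maybe; just; nothing)
open import Data.List using (List; []; _∷_; allFin; reverse; foldl)
open import Relation.Nullary using (¬_; does)
open import Relation.Binary.PropositionalEquality using (_≡_; _≢_)

-- Vertices are Fin n, with T(G) the natural order of Fin n.
-- Edges are Fin m, with T'(G) the natural order of Fin m;
-- edge e joins the two (distinct) vertices  ends e.
record OGraph : Set where
  field
    n : ℕ
    m : ℕ
    ends : Fin m → Fin n × Fin n

  Joins : Fin m → Fin n → Fin n → Set
  Joins e u v = (ends e ≡ (u , v)) ⊎ (ends e ≡ (v , u))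

  field
    loopless : ∀ e → proj₁ (ends e) ≢ proj₂ (ends e)
    simple   : ∀ e f u v → Joins e u v → Joins f u v → e ≡ f

  incident : Fin m → Fin n → Bool
  incident e u = does (proj₁ (ends e) ≟ u) ∨ does (proj₂ (ends e) ≟ u)

  -- Partial height table: H e = row containing e, or 0 if e not yet placed
  -- (rows are indexed from 1).
  Table : Set
  Table = Fin m → ℕ

  firstWhere : {A : Set} → (A → Bool) → List A → Maybe A
  firstWhere p [] = nothing
  firstWhere p (x ∷ xs) = if p x then just x else firstWhere p xs

  largestFree : Table → Fin n → Maybe (Fin m)
  largestFree H u = firstWhere (λ e → (H e ≡ᵇ 0) ∧ incident e u) (reverse (allFin m))

  fillCell : ℕ → Table → Fin n → Table
  fillCell i H u with largestFree H u
  ... | nothing = H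
  ... | just e  = λ f → if does (f ≟ e) then i else H f

  fillRow : ℕ → Table → Table
  fillRow i H = foldl (fillCell i) H (allFin n)

  fillRows : ℕ → Table
  fillRows zero = λ _ → 0
  fillRows (suc k) = fillRow (suc k) (fillRows k)

  -- every row before the table is exhausted places at least one edge,
  -- so m rows place every edge.
  height : Fin m → ℕ
  height = fillRows m

  record MonotonePath (t : ℕ) : Set where
    field
      vtx  : Fin (suc t) → Fin n
      edge : Fin t → Fin m
      distinct   : ∀ i j → vtx i ≡ vtx j → i ≡ j
      joins      : ∀ (i : Fin t) → Joins (edge i) (vtx (Data.Fin.inject₁ i)) (vtx (Data.Fin.suc i))
      increasing : ∀ (i j : Fin t) → i Data.Fin.< j → edge i Data.Fin.< edge j

module Submission where

open import Defs
open import Data.Nat using (ℕ; suc; _<_; _≥_; _∸_)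
open import Data.Nat.Combinatorics using (_C_; nC1≡n; nCk+nC[k+1]≡[n+1]C[k+1])
open import Data.Fin using (Fin; zero; suc; fromℕ)
open import Data.Product using (Σ; _×_)
open import Relation.Binary.PropositionalEquality using (_≡_)

open import Data.Nat as ℕ using (zero; _≤_; _+_; z≤n; s≤s; _≡ᵇ_)
open import Data.Nat.Properties
open import Data.Fin as F using (inject₁; toℕ)
import Data.Fin.Properties as FP
open import Data.Product as Product using (_,_; proj₁; proj₂)
open import Data.Sum using (_⊎_; inj₁; inj₂)
open import Data.Bool using (Bool; true; false; _∧_)
open import Data.Bool.Properties using (∧-conicalˡ; ∧-conicalʳ)
open import Data.Maybe using (just; nothing)
open import Data.List using (List; []; _∷_; allFin; reverse; foldl)
import Data.List.Properties as LP
open import Data.List.Membership.Propositional using (_∈_)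
open import Data.List.Membership.Propositional.Properties using (∈-∃++; ∈-allFin)
open import Data.List.Relation.Unary.Any using (here; there)
import Data.List.Relation.Unary.Any.Properties as AnyP
import Data.List.Relation.Unary.All as All
open import Data.List.Relation.Unary.AllPairs using (AllPairs; []; _∷_)
import Data.List.Relation.Unary.AllPairs.Properties as AllPairsP
open import Relation.Nullary using (¬_; does; yes; no)
open import Relation.Nullary.Decidable using (dec-true)
open import Relation.Unary using (Decidable)
open import Relation.Binary.Definitions using (DecidableEquality)
open import Relation.Binary.PropositionalEquality
  using (_≢_; refl; sym; trans; cong; subst; subst₂)
open import Data.Empty using (⊥-elim)
open import Function using (_∘_; id; flip)

-- Key fact (edgeInRow): if an edge ε at a vertex u has height h, then for
-- every row 1 ≤ i < h the cell A(i,u) holds an edge f > ε at u.  When that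
-- cell is filled ε is still unplaced, so the largest free edge at u is at
-- least ε; and f ≠ ε because f lands in row i < h.
--
-- Extension step (extendPath): let x₀…x_{j+1} be a monotone path whose last
-- edge ε has height R ≥ j+2 and whose last vertex is y.  The j+1 rows
-- R-j-1, …, R-1 give edges f > ε at y of pairwise distinct heights; as G is
-- simple their other endpoints are distinct.  None of them is y (no loops)
-- or x_j (that edge would be ε), so by pigeonhole one of them avoids the
-- j remaining vertices x₀…x_{j-1}; appending it loses at most j+1 in height.
--
-- The theorem follows by induction on the length, using the Pascal identity
-- C(t+1,2) = t + C(t,2) to account for the accumulated loss in height.

snoc : ∀ {A : Set} {k} → (Fin k → A) → A → Fin (suc k) → A
snoc {k = zero}  f a zero    = a
snoc {k = suc k} f a zero    = f zero
snoc {k = suc k} f a (suc i) = snoc (f ∘ suc) a i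

snoc-inject₁ : ∀ {A : Set} {k} (f : Fin k → A) a (i : Fin k) → snoc f a (inject₁ i) ≡ f i
snoc-inject₁ {k = suc k} f a zero    = refl
snoc-inject₁ {k = suc k} f a (suc i) = snoc-inject₁ (f ∘ suc) a i

snoc-last : ∀ {A : Set} {k} (f : Fin k → A) a → snoc f a (fromℕ k) ≡ a
snoc-last {k = zero}  f a = refl
snoc-last {k = suc k} f a = snoc-last (f ∘ suc) a

data InitOrLast : ∀ {k} → Fin (suc k) → Set where
  old : ∀ {k} (j : Fin k) → InitOrLast (inject₁ j)
  new : ∀ {k} → InitOrLast (fromℕ k)

initOrLast : ∀ {k} (i : Fin (suc k)) → InitOrLast i
initOrLast {zero}  zero    = new
initOrLast {suc k} zero    = old zero
initOrLast {suc k} (suc i) with initOrLast i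
... | old j = old (suc j)
... | new   = new

inject₁<fromℕ : ∀ {k} (j : Fin k) → inject₁ j F.< fromℕ k
inject₁<fromℕ {k} j rewrite FP.toℕ-inject₁ j | FP.toℕ-fromℕ k = FP.toℕ<n j

escape : ∀ {A : Set} → DecidableEquality A → ∀ {k} (g : Fin (suc k) → A) →
         (∀ a b → g a ≡ g b → a ≡ b) → (h : Fin k → A) →
         Σ (Fin (suc k)) λ a → ∀ l → g a ≢ h l
escape _≟_ {k} g g-injective h =
  Product.map id (λ uncovered l eq → uncovered (l , eq)) (FP.¬∀⟶∃¬ (suc k) Covered covered? notAll)
  where
  Covered : Fin (suc k) → Set
  Covered a = Σ (Fin k) λ l → g a ≡ h l

  covered? : Decidable Covered
  covered? a = FP.any? (λ l → g a ≟ h l)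

  notAll : ¬ (∀ a → Covered a)
  notAll cover with FP.pigeonhole (n<1+n k) (proj₁ ∘ cover)
  ... | a , b , a<b , same = <-irrefl (cong toℕ (g-injective a b ga≡gb)) a<b
    where
    ga≡gb : g a ≡ g b
    ga≡gb = trans (proj₂ (cover a)) (trans (cong h same) (sym (proj₂ (cover b))))

allPairs-reverse : ∀ {A : Set} {R : A → A → Set} {xs : List A} →
                   AllPairs R xs → AllPairs (flip R) (reverse xs)
allPairs-reverse {xs = []} [] = []
allPairs-reverse {xs = x ∷ xs} (Rx ∷ Rxs) rewrite LP.unfold-reverse x xs =
  AllPairsP.++⁺ (allPairs-reverse Rxs) (All.[] ∷ [])
    (All.tabulate (λ y∈ → All.lookup Rx (AnyP.reverse⁻ y∈) All.∷ All.[]))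

isZero-sound : ∀ k → (k ≡ᵇ 0) ≡ true → k ≡ 0
isZero-sound zero _ = refl

module _ (G : OGraph) where
  open OGraph G

  joins-flip : ∀ {e u v} → Joins e u v → Joins e v u
  joins-flip (inj₁ eq) = inj₂ eq
  joins-flip (inj₂ eq) = inj₁ eq

  joins-distinct : ∀ {e u v} → Joins e u v → u ≢ v
  joins-distinct {e} (inj₁ eq) u≡v = loopless e (trans (cong proj₁ eq) (trans u≡v (sym (cong proj₂ eq))))
  joins-distinct {e} (inj₂ eq) u≡v = loopless e (trans (cong proj₁ eq) (trans (sym u≡v) (sym (cong proj₂ eq))))

  joins⇒incident : ∀ {e u v} → Joins e u v → incident e u ≡ true
  joins⇒incident {u = u} (inj₁ eq) rewrite eq | dec-true (u F.≟ u) refl = refl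
  joins⇒incident {u = u} {v} (inj₂ eq) rewrite eq | dec-true (u F.≟ u) refl with does (v F.≟ u)
  ... | true  = refl
  ... | false = refl

  incident⇒joins : ∀ e u → incident e u ≡ true → Σ (Fin n) λ v → Joins e u v
  incident⇒joins e u inc with proj₁ (ends e) F.≟ u
  ... | yes eq = proj₂ (ends e) , inj₁ (cong (_, proj₂ (ends e)) eq)
  ... | no _ with proj₂ (ends e) F.≟ u
  ...   | yes eq = proj₁ (ends e) , inj₂ (cong (proj₁ (ends e) ,_) eq)
  incident⇒joins e u () | no _ | no _

  firstWhere-sound : ∀ {A : Set} (p : A → Bool) xs {x} → firstWhere p xs ≡ just x → p x ≡ true
  firstWhere-sound p (y ∷ ys) eq with p y in py
  firstWhere-sound p (y ∷ ys) refl | true = py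
  ... | false = firstWhere-sound p ys eq

  firstWhere-max : ∀ {k} (p : Fin k → Bool) xs {x} → AllPairs (flip F._<_) xs →
                   p x ≡ true → x ∈ xs → Σ (Fin k) λ f → firstWhere p xs ≡ just f × x F.≤ f
  firstWhere-max p (y ∷ ys) {x} (y>ys ∷ desc) px x∈ with p y in py | x∈
  ... | true  | here refl = y , refl , ≤-refl
  ... | true  | there x∈ys = y , refl , <⇒≤ (All.lookup y>ys x∈ys)
  ... | false | here refl with () ← trans (sym px) py
  ... | false | there x∈ys = firstWhere-max p ys desc px x∈ys

  edgesDescending : AllPairs (flip F._<_) (reverse (allFin m))
  edgesDescending = allPairs-reverse (AllPairsP.tabulate⁺-< id)

  Step : ℕ → Table → Table → Set
  Step i H H' = ∀ f → (H' f ≡ H f) ⊎ ((H f ≡ 0) × (H' f ≡ i))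

  step-trans : ∀ {i H₁ H₂ H₃} → Step i H₁ H₂ → Step i H₂ H₃ → Step i H₁ H₃
  step-trans s₁ s₂ f with s₁ f | s₂ f
  ... | inj₁ e₁₂       | inj₁ e₂₃       = inj₁ (trans e₂₃ e₁₂)
  ... | inj₁ e₁₂       | inj₂ (z₂ , v₃) = inj₂ (trans (sym e₁₂) z₂ , v₃)
  ... | inj₂ (z₁ , v₂) | inj₁ e₂₃       = inj₂ (z₁ , trans e₂₃ v₂)
  ... | inj₂ (z₁ , _)  | inj₂ (_ , v₃)  = inj₂ (z₁ , v₃)

  step-keeps : ∀ {i H H' f} → Step i H H' → H f ≢ 0 → H' f ≡ H f
  step-keeps {f = f} s placed with s f
  ... | inj₁ eq       = eq
  ... | inj₂ (z , _)  = ⊥-elim (placed z)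

  step-free : ∀ {i H H' f} → Step (suc i) H H' → H' f ≡ 0 → H f ≡ 0
  step-free {f = f} s free with s f
  ... | inj₁ eq      = trans (sym eq) free
  ... | inj₂ (z , _) = z

  step-bounded : ∀ {i H H' f} → Step i H H' → H f ≤ i → H' f ≤ i
  step-bounded {f = f} s bound with s f
  ... | inj₁ eq      = subst (_≤ _) (sym eq) bound
  ... | inj₂ (_ , v) = ≤-reflexive v

  isFreeAt : Table → Fin n → Fin m → Bool
  isFreeAt H u e = (H e ≡ᵇ 0) ∧ incident e u

  fillCell-step : ∀ i H u → Step i H (fillCell i H u)
  fillCell-step i H u f with largestFree H u in sel
  ... | nothing = inj₁ refl
  ... | just e with f F.≟ e
  ...   | yes refl = inj₂ (isZero-sound (H f) (∧-conicalˡ _ _ (firstWhere-sound (isFreeAt H u) (reverse (allFin m)) sel)) , refl)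
  ...   | no _     = inj₁ refl

  fillCell-selected : ∀ i H u f → largestFree H u ≡ just f → fillCell i H u f ≡ i
  fillCell-selected i H u f sel with largestFree H u
  fillCell-selected i H u f refl | just .f rewrite dec-true (f F.≟ f) refl = refl

  largestFree-above : ∀ H u ε → H ε ≡ 0 → incident ε u ≡ true →
    Σ (Fin m) λ f → largestFree H u ≡ just f × ε F.≤ f × incident f u ≡ true
  largestFree-above H u ε free inc = f , sel , ε≤f , ∧-conicalʳ _ _ (firstWhere-sound (isFreeAt H u) (reverse (allFin m)) sel)
    where
    free-ε : isFreeAt H u ε ≡ true
    free-ε rewrite free | inc = refl
    found = firstWhere-max (isFreeAt H u) (reverse (allFin m)) edgesDescending free-ε (AnyP.reverse⁺ (∈-allFin ε))
    f = proj₁ found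
    sel = proj₁ (proj₂ found)
    ε≤f = proj₂ (proj₂ found)

  fillCells-step : ∀ i H us → Step i H (foldl (fillCell i) H us)
  fillCells-step i H []       f = inj₁ refl
  fillCells-step i H (u ∷ us) = step-trans (fillCell-step i H u) (fillCells-step i (fillCell i H u) us)

  -- The moment cell (i,u) is filled: from the table Hu just before it, the rest
  -- of row i only performs a filling stage.
  cellMoment : ∀ i H u → Σ Table λ Hu → Step i (fillCell i Hu u) (fillRow i H)
  cellMoment i H u with ∈-∃++ (∈-allFin u)
  ... | ys , zs , split = foldl c H ys , subst (Step i (c Hu u)) (sym rowEq) (fillCells-step i (c Hu u) zs)
    where
    c = fillCell i
    Hu = foldl c H ys
    rowEq : fillRow i H ≡ foldl c (c Hu u) zs
    rowEq = trans (cong (foldl c H) split) (LP.foldl-++ c H ys (u ∷ zs))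

  rows-bounded : ∀ k e → fillRows k e ≤ k
  rows-bounded zero    e = z≤n
  rows-bounded (suc k) e = step-bounded (fillCells-step (suc k) (fillRows k) (allFin n)) (m≤n⇒m≤1+n (rows-bounded k e))

  rows-stable : ∀ d k e → fillRows k e ≢ 0 → fillRows (d + k) e ≡ fillRows k e
  rows-stable zero    k e placed = refl
  rows-stable (suc d) k e placed =
    trans (step-keeps (fillCells-step (suc (d + k)) (fillRows (d + k)) (allFin n)) placed′) IH
    where
    IH = rows-stable d k e placed
    placed′ : fillRows (d + k) e ≢ 0
    placed′ z = placed (trans (sym IH) z)

  height-at : ∀ k e → k ≤ m → fillRows k e ≢ 0 → height e ≡ fillRows k e
  height-at k e k≤m placed =
    trans (cong (λ j → fillRows j e) (sym (m∸n+n≡m k≤m))) (rows-stable (m ∸ k) k e placed)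

  free-before : ∀ ε i → i < height ε → fillRows i ε ≡ 0
  free-before ε i i<h with fillRows i ε ℕ.≟ 0
  ... | yes free   = free
  ... | no placed = ⊥-elim (<⇒≢ (≤-trans i<h (≤-trans (≤-reflexive (height-at i ε i≤m placed)) (rows-bounded i ε))) refl)
    where
    i≤m : i ≤ m
    i≤m = ≤-trans (<⇒≤ i<h) (rows-bounded m ε)

  edgeInRow : ∀ {ε u w} → Joins ε u w → ∀ i → suc i < height ε →
              Σ (Fin m) λ f → Σ (Fin n) λ v → Joins f u v × height f ≡ suc i × ε F.< f
  edgeInRow {ε} {u} jε i i<h = f , proj₁ other , proj₂ other , height-f , ε<f
    where
    moment = cellMoment (suc i) (fillRows i) u
    Hu = proj₁ moment
    rest = proj₂ moment
    ε-free : Hu ε ≡ 0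
    ε-free = step-free (step-trans (fillCell-step (suc i) Hu u) rest) (free-before ε (suc i) i<h)
    chosen = largestFree-above Hu u ε ε-free (joins⇒incident jε)
    f = proj₁ chosen
    ε≤f = proj₁ (proj₂ (proj₂ chosen))
    other = incident⇒joins f u (proj₂ (proj₂ (proj₂ chosen)))
    row-f : fillRows (suc i) f ≡ suc i
    row-f = trans (step-keeps rest (λ z → 1+n≢0 (trans (sym cell-f) z))) cell-f
      where
      cell-f = fillCell-selected (suc i) Hu u f (proj₁ (proj₂ chosen))
    height-f : height f ≡ suc i
    height-f = trans (height-at (suc i) f (≤-trans (<⇒≤ i<h) (rows-bounded m ε)) (λ z → 1+n≢0 (trans (sym row-f) z))) row-f
    ε<f : ε F.< f
    ε<f = ≤∧≢⇒< ε≤f (λ same → <⇒≢ i<h (sym (trans (cong height (FP.toℕ-injective same)) height-f)))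

  lastVertex : ∀ {j} → MonotonePath j → Fin n
  lastVertex {j} P = MonotonePath.vtx P (fromℕ j)

  lastEdge : ∀ {j} → MonotonePath (suc j) → Fin m
  lastEdge {j} P = MonotonePath.edge P (fromℕ j)

  edgePath : ∀ {e x₀ x₁} → Joins e x₀ x₁ → MonotonePath 1
  edgePath {e} {x₀} {x₁} je = record
    { vtx        = λ { zero → x₀ ; (suc zero) → x₁ }
    ; edge       = λ _ → e
    ; distinct   = λ { zero zero _ → refl
                     ; zero (suc zero) x₀≡x₁ → ⊥-elim (joins-distinct je x₀≡x₁)
                     ; (suc zero) zero x₁≡x₀ → ⊥-elim (joins-distinct je (sym x₁≡x₀))
                     ; (suc zero) (suc zero) _ → refl }
    ; joins      = λ { zero → je }
    ; increasing = λ { zero zero () }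
    }

  append : ∀ {j} (P : MonotonePath (suc j)) z f → (∀ i → MonotonePath.vtx P i ≢ z) →
           Joins f (lastVertex P) z → lastEdge P F.< f → MonotonePath (suc (suc j))
  append {j} P z f fresh jf last<f = record
    { vtx = vtx′ ; edge = edge′ ; distinct = distinct′ ; joins = joins′ ; increasing = increasing′ }
    where
    open MonotonePath P

    vtx′ : Fin (suc (suc (suc j))) → Fin n
    vtx′ = snoc vtx z

    edge′ : Fin (suc (suc j)) → Fin m
    edge′ = snoc edge f

    distinct′ : ∀ a b → vtx′ a ≡ vtx′ b → a ≡ b
    distinct′ a b eq with initOrLast a | initOrLast b
    ... | old a′ | old b′ = cong inject₁ (distinct a′ b′ (trans (sym (snoc-inject₁ vtx z a′)) (trans eq (snoc-inject₁ vtx z b′))))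
    ... | old a′ | new    = ⊥-elim (fresh a′ (trans (sym (snoc-inject₁ vtx z a′)) (trans eq (snoc-last vtx z))))
    ... | new    | old b′ = ⊥-elim (fresh b′ (trans (sym (snoc-inject₁ vtx z b′)) (trans (sym eq) (snoc-last vtx z))))
    ... | new    | new    = refl

    joins′ : ∀ i → Joins (edge′ i) (vtx′ (inject₁ i)) (vtx′ (suc i))
    joins′ i with initOrLast i
    ... | old i′ rewrite snoc-inject₁ edge f i′ | snoc-inject₁ vtx z (inject₁ i′) | snoc-inject₁ vtx z (suc i′) = joins i′
    ... | new    rewrite snoc-last edge f | snoc-inject₁ vtx z (fromℕ (suc j)) | snoc-last vtx z = jf

    below-last : ∀ a → edge a F.≤ lastEdge P
    below-last a with initOrLast a
    ... | old a′ = <⇒≤ (increasing (inject₁ a′) (fromℕ j) (inject₁<fromℕ a′))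
    ... | new    = ≤-refl

    increasing′ : ∀ a b → a F.< b → edge′ a F.< edge′ b
    increasing′ a b a<b with initOrLast a | initOrLast b
    ... | old a′ | old b′ =
      subst₂ F._<_ (sym (snoc-inject₁ edge f a′)) (sym (snoc-inject₁ edge f b′))
        (increasing a′ b′ (subst₂ ℕ._<_ (FP.toℕ-inject₁ a′) (FP.toℕ-inject₁ b′) a<b))
    ... | old a′ | new    = subst₂ F._<_ (sym (snoc-inject₁ edge f a′)) (sym (snoc-last edge f)) (≤-<-trans (below-last a′) last<f)
    ... | new    | old b′ = ⊥-elim (<-asym a<b (inject₁<fromℕ b′))
    ... | new    | new    = ⊥-elim (<-irrefl refl a<b)

  -- A vertex z joined to the last vertex by an edge f larger than the last
  -- edge ε, and distinct from x₀ … x_{j-1}, lies off the path x₀ … x_{j+1}: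
  -- it is not x_{j+1} as G has no loops, and not x_j as then f = ε.
  offPath : ∀ {j} (P : MonotonePath (suc j)) {z f} → Joins f (lastVertex P) z → lastEdge P F.< f →
            (∀ l → MonotonePath.vtx P (inject₁ (inject₁ l)) ≢ z) → ∀ i → MonotonePath.vtx P i ≢ z
  offPath {j} P {f = f} jf ε<f avoids i with initOrLast i
  ... | new = joins-distinct jf
  ... | old i′ with initOrLast i′
  ...   | old l = avoids l
  ...   | new   = λ x≡z → <⇒≢ ε<f (cong toℕ (simple _ f _ _ (joins-flip (joins (fromℕ j))) (subst (Joins f _) (sym x≡z) jf)))
    where open MonotonePath P

  Candidates : ∀ {j} → MonotonePath (suc j) → ℕ → Set
  Candidates {j} P d = ∀ (k : Fin (suc j)) → Σ (Fin m) λ f → Σ (Fin n) λ v →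
    Joins f (lastVertex P) v × height f ≡ suc (d + toℕ k) × lastEdge P F.< f

  -- The candidates have distinct heights, so (G being simple) distinct other
  -- endpoints; by pigeonhole one of these j+1 endpoints avoids x₀ … x_{j-1}.
  extendVia : ∀ {j} (P : MonotonePath (suc j)) d → Candidates P d →
    Σ (MonotonePath (suc (suc j))) λ Q →
      (MonotonePath.vtx Q zero ≡ MonotonePath.vtx P zero) ×
      (MonotonePath.vtx Q (suc zero) ≡ MonotonePath.vtx P (suc zero)) ×
      (suc d ≤ height (lastEdge Q))
  extendVia {j} P d candidate with escape F._≟_ endpoint endpoint-injective earlier
    where
    endpoint : Fin (suc j) → Fin n
    endpoint k = proj₁ (proj₂ (candidate k))

    earlier : Fin j → Fin n
    earlier l = MonotonePath.vtx P (inject₁ (inject₁ l))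

    endpoint-injective : ∀ a b → endpoint a ≡ endpoint b → a ≡ b
    endpoint-injective a b same with candidate a | candidate b
    ... | fa , _ , ja , ha , _ | fb , _ , jb , hb , _ =
      FP.toℕ-injective (+-cancelˡ-≡ d _ _ (suc-injective (trans (sym ha) (trans (cong height same-edge) hb))))
      where
      same-edge : fa ≡ fb
      same-edge = simple fa fb _ _ (subst (Joins fa _) same ja) jb
  ... | k , avoids with candidate k
  ...   | f , z , jf , height-f , ε<f =
    append P z f (offPath P jf ε<f (λ l → avoids l ∘ sym)) jf ε<f , refl , refl ,
    ≤-trans (s≤s (m≤m+n d (toℕ k)))
      (≤-reflexive (trans (sym height-f) (cong height (sym (snoc-last (MonotonePath.edge P) f)))))

  extendPath : ∀ {j} (P : MonotonePath (suc j)) → suc (suc j) ≤ height (lastEdge P) →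
    Σ (MonotonePath (suc (suc j))) λ Q →
      (MonotonePath.vtx Q zero ≡ MonotonePath.vtx P zero) ×
      (MonotonePath.vtx Q (suc zero) ≡ MonotonePath.vtx P (suc zero)) ×
      (height (lastEdge P) ∸ suc j ≤ height (lastEdge Q))
  extendPath {j} P room =
    let (Q , Q₀ , Q₁ , height-Q) = extendVia P d candidates
    in Q , Q₀ , Q₁ , subst (_≤ height (lastEdge Q)) loss height-Q
    where
    R = height (lastEdge P)
    d = R ∸ suc (suc j)

    row-below : ∀ (k : Fin (suc j)) → suc (d + toℕ k) < R
    row-below k = begin-strict
      suc (d + toℕ k)  ≡⟨ sym (+-suc d (toℕ k)) ⟩
      d + suc (toℕ k)  ≤⟨ +-monoʳ-≤ d (FP.toℕ<n k) ⟩
      d + suc j        <⟨ +-monoʳ-< d (n<1+n (suc j)) ⟩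
      d + suc (suc j)  ≡⟨ m∸n+n≡m room ⟩
      R                ∎
      where open ≤-Reasoning

    candidates : Candidates P d
    candidates k = edgeInRow (joins-flip (MonotonePath.joins P (fromℕ j))) (d + toℕ k) (row-below k)

    loss : suc d ≡ R ∸ suc j
    loss = sym (+-∸-assoc 1 room)

choose2-suc : ∀ t → suc t C 2 ≡ t + t C 2
choose2-suc t = trans (sym (nCk+nC[k+1]≡[n+1]C[k+1] t 1)) (cong (_+ t C 2) (nC1≡n t))

budget : ∀ {r c t R} → t + c < r → r ∸ c ≤ R → suc t ≤ R × r ∸ (t + c) ≤ R ∸ t
budget {r} {c} {t} {R} t+c<r r∸c≤R = room , remaining
  where
  open ≤-Reasoning
  room : suc t ≤ R
  room = begin
    suc t              ≡⟨ sym (m+n∸n≡m (suc t) c) ⟩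
    suc t + c ∸ c      ≤⟨ ∸-monoˡ-≤ c t+c<r ⟩
    r ∸ c              ≤⟨ r∸c≤R ⟩
    R                  ∎
  remaining : r ∸ (t + c) ≤ R ∸ t
  remaining = begin
    r ∸ (t + c)        ≡⟨ cong (r ∸_) (+-comm t c) ⟩
    r ∸ (c + t)        ≡⟨ sym (∸-+-assoc r c t) ⟩
    r ∸ c ∸ t          ≤⟨ ∸-monoˡ-≤ t r∸c≤R ⟩
    R ∸ t              ∎

lemma2p2 : (G : OGraph) → let open OGraph G in
    (x₀ x₁ : Fin n) (e : Fin m) → Joins e x₀ x₁ →
    (r : ℕ) → height e ≡ r →
    (s : ℕ) → (suc s) C 2 < r →
    Σ (MonotonePath (suc s)) λ P →
    (MonotonePath.vtx P zero ≡ x₀) × (MonotonePath.vtx P (suc zero) ≡ x₁) ×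
    (height (MonotonePath.edge P (fromℕ s)) ≥ r ∸ (suc s) C 2)
lemma2p2 G x₀ x₁ e je r hr zero _ = edgePath G je , refl , refl , ≤-reflexive (sym hr)
lemma2p2 G x₀ x₁ e je r hr (suc s) h =
  let t = suc s
      t+c<r = subst (_< r) (choose2-suc t) h
      (P , P₀ , P₁ , height-P) = lemma2p2 G x₀ x₁ e je r hr s (≤-<-trans (m≤n+m (t C 2) t) t+c<r)
      (room , remaining) = budget t+c<r height-P
      (Q , Q₀ , Q₁ , height-Q) = extendPath G P room
  in Q , trans Q₀ P₀ , trans Q₁ P₁ ,
     subst (λ c → r ∸ c ≤ OGraph.height G (lastEdge G Q)) (sym (choose2-suc t)) (≤-trans remaining height-Q)
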